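{- For each integer $k\ge2$ there exist polynomials $b_k,c_k,d_k,p_k$ (in one variable, real coefficients) such that (1) $T_b(3,n;k)=b_k(n)$, $T_c(3,n;k)=c_k(n)$, $T_d(3,n;k)=d_k(n)$ and $T(3,n;k)=p_k(n)$ for all integers $n\ge k$; and (2) $\deg b_k=\deg c_k=k-1$, $\deg d_k=k-2$, and $\deg p_k=k$.
   Context: For integers $n\ge0$, $k\ge0$, $T(3,n;k)$ denotes the number of ways to select a set of $k$ squares from a $3\times n$ grid of unit squares ($3$ rows, $n$ columns) with no two selected squares horizontally or vertically adjacent (sharing an edge). For $n\ge1$: $T_b(3,n;k)$ is the number of such selections in which the last column contains exactly one selected square, namely its bottom square; $T_c(3,n;k)$ is the number of such selections in which the last column contains exactly one selected square, namely its center square; $T_d(3,n;k)$ is the number of such selections in which the last column contains two selected squares. -}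

module Defs where

open import Data.Bool using (Bool; true; false; _∧_; _∨_; not; if_then_else_)
open import Data.Nat using (ℕ; zero; suc; _≡ᵇ_)
import Data.Nat as ℕ
open import Data.List using (List; []; _∷_; _++_; [_]; length; filterᵇ; concatMap; map)
open import Data.Vec using (Vec; []; _∷_)
open import Data.Maybe using (Maybe; just; nothing)
open import Data.Product using (Σ; _×_)
open import Data.Integer using (+_)
open import Data.Rational using (ℚ; 0ℚ; _+_; _*_; _/_)
open import Relation.Binary.PropositionalEquality using (_≡_; _≢_)

-- A grid selection is a vector of n columns (column 1
-- first, column n = the last column); a column is a Vec Bool 3 listing
-- (top, center, bottom); 'true' means the square is selected.

Column : Set
Column = Vec Bool 3

Grid : ℕ → Set
Grid n = Vec Column n

bools : List Bool
bools = true ∷ false ∷ []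

allColumns : List Column
allColumns = concatMap (λ a → concatMap (λ b → map (λ c → a ∷ b ∷ c ∷ []) bools) bools) bools

allGrids : (n : ℕ) → List (Grid n)
allGrids zero = [] ∷ []
allGrids (suc n) = concatMap (λ g → map (λ c → c ∷ g) allColumns) (allGrids n)

colOK : Column → Bool
colOK (a ∷ b ∷ c ∷ []) = not (a ∧ b) ∧ not (b ∧ c)

adjOK : Column → Column → Bool
adjOK (a ∷ b ∷ c ∷ []) (a' ∷ b' ∷ c' ∷ []) = not (a ∧ a') ∧ not (b ∧ b') ∧ not (c ∧ c')

independent : {n : ℕ} → Grid n → Bool
independent [] = true
independent (c ∷ []) = colOK c
independent (c ∷ d ∷ g) = colOK c ∧ adjOK c d ∧ independent (d ∷ g)

colWeight : Column → ℕ
colWeight (a ∷ b ∷ c ∷ []) = w a ℕ.+ w b ℕ.+ w c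
  where
  w : Bool → ℕ
  w true = 1
  w false = 0

weight : {n : ℕ} → Grid n → ℕ
weight [] = 0
weight (c ∷ g) = colWeight c ℕ.+ weight g

lastColumn : {n : ℕ} → Grid n → Maybe Column
lastColumn [] = nothing
lastColumn (c ∷ []) = just c
lastColumn (c ∷ d ∷ g) = lastColumn (d ∷ g)

lastIsBottom lastIsCenter lastHasTwo : {n : ℕ} → Grid n → Bool
lastIsBottom g with lastColumn g
... | just (false ∷ false ∷ true ∷ []) = true
... | _ = false
lastIsCenter g with lastColumn g
... | just (false ∷ true ∷ false ∷ []) = true
... | _ = false
lastHasTwo g with lastColumn g
... | just c = colWeight c ≡ᵇ 2
... | nothing = false

countSel : (P : {n : ℕ} → Grid n → Bool) → ℕ → ℕ → ℕ
countSel P n k = length (filterᵇ (λ g → independent g ∧ (weight g ≡ᵇ k) ∧ P g) (allGrids n))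

T Tb Tc Td : ℕ → ℕ → ℕ
T  = countSel (λ _ → true)
Tb = countSel lastIsBottom
Tc = countSel lastIsCenter
Td = countSel lastHasTwo

-- Univariate polynomials with rational coefficients, as coefficient
-- lists a₀ ∷ a₁ ∷ … (constant term first).

Poly : Set
Poly = List ℚ

eval : Poly → ℚ → ℚ
eval [] x = 0ℚ
eval (a ∷ as) x = a + x * eval as x

ℕtoℚ : ℕ → ℚ
ℕtoℚ n = + n / 1

HasDegree : Poly → ℕ → Set
HasDegree p m = Σ (List ℚ) λ as → Σ ℚ λ a → (p ≡ as ++ [ a ]) × (length as ≡ m) × (a ≢ 0ℚ)

module Submission where

-- Let ending m k d count the k-selections of the 3 × (m+1)
-- grid whose last column is d.  Removing the last column gives linear
-- recurrences between the five admissible columns (empty, top, center,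
-- bottom, top+bottom), and Tb, Tc, Td, T are read off from them.
--
-- For weight j + 1 the sequences m ↦ ending m (j+1) d with
-- d a single square have j-th difference constantly 3^j from m = j on; the
-- recurrences propagate this to weight j + 2, give order j and value 3^j for
-- top+bottom at weight j + 2, and order k and value 3^k for the empty column.
--
-- A rational sequence whose d-th difference is
-- eventually a constant v ≠ 0 agrees from then on with its Newton polynomial
-- Σ_{i ≤ d} Δ^i f(N) · C(x - N, i), whose degree is exactly d (leading
-- coefficient v / d!).

open import Defs
open import Data.Nat using (ℕ; _≤_; _∸_)
open import Data.Product using (Σ; _×_)
open import Relation.Binary.PropositionalEquality using (_≡_)

module NatEmbedding where

  open import Defs
  open import Data.Nat as ℕ using (ℕ; suc)
  open import Data.Integer as ℤ using (+_)
  import Data.Integer.Properties as ℤ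
  open import Data.Rational using (ℚ; 1ℚ; _+_; _*_; _/_; toℚᵘ)
  open import Data.Rational.Properties using (toℚᵘ-injective; toℚᵘ-fromℚᵘ; toℚᵘ-homo-+; toℚᵘ-homo-*)
  import Data.Rational.Unnormalised as ᵘ
  import Data.Rational.Unnormalised.Properties as ᵘ
  open import Relation.Binary.PropositionalEquality
  open import Data.Nat.Solver using (module +-*-Solver)
  open +-*-Solver using (solve; _:+_; _:*_; con; _:=_)

  ℕtoℚᵘ : ∀ n → toℚᵘ (ℕtoℚ n) ᵘ.≃ ᵘ.mkℚᵘ (+ n) 0
  ℕtoℚᵘ n = toℚᵘ-fromℚᵘ (ᵘ.mkℚᵘ (+ n) 0)

  ℕtoℚ-+ : ∀ m n → ℕtoℚ (m ℕ.+ n) ≡ ℕtoℚ m + ℕtoℚ n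
  ℕtoℚ-+ m n = toℚᵘ-injective (begin
    toℚᵘ (ℕtoℚ (m ℕ.+ n))                        ≈⟨ ℕtoℚᵘ (m ℕ.+ n) ⟩
    ᵘ.mkℚᵘ (+ (m ℕ.+ n)) 0                        ≈⟨ ᵘ.*≡* (cong (ℤ._* + 1) (sym (cong₂ ℤ._+_ (ℤ.*-identityʳ (+ m)) (ℤ.*-identityʳ (+ n))))) ⟩
    ᵘ.mkℚᵘ (+ m) 0 ᵘ.+ ᵘ.mkℚᵘ (+ n) 0             ≈⟨ ᵘ.≃-sym (ᵘ.+-cong (ℕtoℚᵘ m) (ℕtoℚᵘ n)) ⟩
    toℚᵘ (ℕtoℚ m) ᵘ.+ toℚᵘ (ℕtoℚ n)              ≈⟨ ᵘ.≃-sym (toℚᵘ-homo-+ (ℕtoℚ m) (ℕtoℚ n)) ⟩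
    toℚᵘ (ℕtoℚ m + ℕtoℚ n) ∎)
    where open ᵘ.≃-Reasoning

  ℕtoℚ-injective : ∀ {m n} → ℕtoℚ m ≡ ℕtoℚ n → m ≡ n
  ℕtoℚ-injective {m} {n} eq with ᵘ.≃-trans (ᵘ.≃-sym (ℕtoℚᵘ m)) (ᵘ.≃-trans (ᵘ.≃-reflexive (cong toℚᵘ eq)) (ℕtoℚᵘ n))
  ... | ᵘ.*≡* e = ℤ.+-injective (trans (sym (ℤ.*-identityʳ (+ m))) (trans e (ℤ.*-identityʳ (+ n))))

  recip : ℕ → ℚ
  recip j = + 1 / suc j

  recip-inverse : ∀ j → recip j * ℕtoℚ (suc j) ≡ 1ℚ
  recip-inverse j = toℚᵘ-injective (begin
    toℚᵘ (recip j * ℕtoℚ (suc j))                  ≈⟨ toℚᵘ-homo-* (recip j) (ℕtoℚ (suc j)) ⟩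
    toℚᵘ (recip j) ᵘ.* toℚᵘ (ℕtoℚ (suc j))         ≈⟨ ᵘ.*-cong (toℚᵘ-fromℚᵘ (ᵘ.mkℚᵘ (+ 1) j)) (ℕtoℚᵘ (suc j)) ⟩
    ᵘ.mkℚᵘ (+ 1) j ᵘ.* ᵘ.mkℚᵘ (+ suc j) 0           ≈⟨ ᵘ.*≡* (cong (λ z → + suc z) (solve 1 (λ j → (j :+ con 0) :* con 1 := j :* con 1 :+ con 0) refl j)) ⟩
    toℚᵘ 1ℚ ∎)
    where open ᵘ.≃-Reasoning

  ℕtoℚ-suc : ∀ n → ℕtoℚ (suc n) ≡ 1ℚ + ℕtoℚ n
  ℕtoℚ-suc = ℕtoℚ-+ 1

  ℕtoℚ-+₃ : ∀ a b c → ℕtoℚ ((a ℕ.+ b) ℕ.+ c) ≡ (ℕtoℚ a + ℕtoℚ b) + ℕtoℚ c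
  ℕtoℚ-+₃ a b c = trans (ℕtoℚ-+ (a ℕ.+ b) c) (cong (_+ ℕtoℚ c) (ℕtoℚ-+ a b))

  ℕtoℚ-+₄ : ∀ a b c d → ℕtoℚ (((a ℕ.+ b) ℕ.+ c) ℕ.+ d) ≡ ((ℕtoℚ a + ℕtoℚ b) + ℕtoℚ c) + ℕtoℚ d
  ℕtoℚ-+₄ a b c d = trans (ℕtoℚ-+ ((a ℕ.+ b) ℕ.+ c) d) (cong (_+ ℕtoℚ d) (ℕtoℚ-+₃ a b c))

module FiniteDifferences where

  open import Data.Nat as ℕ using (ℕ; zero; suc; _≤_)
  import Data.Nat.Properties as ℕ
  open import Data.Rational using (ℚ; 0ℚ; _+_; _-_)
  import Data.Rational.Properties as ℚ
  open import Data.Rational.Solver using (module +-*-Solver)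
  open +-*-Solver using (solve; _:+_; _:-_; _:=_)
  open import Relation.Binary.PropositionalEquality
  open ≡-Reasoning

  Seq : Set
  Seq = ℕ → ℚ

  Δ : Seq → Seq
  Δ f n = f (suc n) - f n

  Δ^ : ℕ → Seq → Seq
  Δ^ zero f = f
  Δ^ (suc d) f = Δ^ d (Δ f)

  infixl 6 _+ₛ_
  _+ₛ_ : Seq → Seq → Seq
  (f +ₛ g) n = f n + g n

  AgreeFrom : ℕ → Seq → Seq → Set
  AgreeFrom N f g = ∀ n → N ≤ n → f n ≡ g n

  record ConstDiff (d N : ℕ) (f : Seq) (v : ℚ) : Set where
    constructor constDiff
    field holds : ∀ n → N ≤ n → Δ^ d f n ≡ v
  open ConstDiff public

  -- differences only look forward, so eventual agreement is preserved
  Δ^-agree : ∀ d {N f g} → AgreeFrom N f g → AgreeFrom N (Δ^ d f) (Δ^ d g)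
  Δ^-agree zero eq = eq
  Δ^-agree (suc d) eq = Δ^-agree d (λ n N≤n → cong₂ _-_ (eq (suc n) (ℕ.m≤n⇒m≤1+n N≤n)) (eq n N≤n))

  Δ^-+ : ∀ d f g n → Δ^ d (f +ₛ g) n ≡ Δ^ d f n + Δ^ d g n
  Δ^-+ zero f g n = refl
  Δ^-+ (suc d) f g n = trans (Δ^-agree d {0} regroup n ℕ.z≤n) (Δ^-+ d (Δ f) (Δ g) n)
    where
    regroup : AgreeFrom 0 (Δ (f +ₛ g)) (Δ f +ₛ Δ g)
    regroup m _ = solve 4 (λ a b c e → (a :+ b) :- (c :+ e) := (a :- c) :+ (b :- e)) refl
                          (f (suc m)) (g (suc m)) (f m) (g m)

  Δ^-suc : ∀ d f n → Δ^ (suc d) f n ≡ Δ (Δ^ d f) n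
  Δ^-suc zero f n = refl
  Δ^-suc (suc d) f n = Δ^-suc d (Δ f) n

  Δ^-shift : ∀ d f n → Δ^ d (λ m → f (suc m)) n ≡ Δ^ d f (suc n)
  Δ^-shift zero f n = refl
  Δ^-shift (suc d) f n = Δ^-shift d (Δ f) n

  constant : ∀ {N f v} → (∀ n → f n ≡ v) → ConstDiff 0 N f v
  constant eq = constDiff (λ n _ → eq n)

  add : ∀ {d N f g v u} → ConstDiff d N f v → ConstDiff d N g u → ConstDiff d N (f +ₛ g) (v + u)
  add {d} {f = f} {g} F G = constDiff λ n N≤n → trans (Δ^-+ d f g n) (cong₂ _+_ (holds F n N≤n) (holds G n N≤n))

  raise : ∀ {d N f v} → ConstDiff d N f v → ConstDiff (suc d) N f 0ℚ
  raise {d} {f = f} {v} F = constDiff λ n N≤n → begin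
    Δ^ (suc d) f n                    ≡⟨ Δ^-suc d f n ⟩
    Δ^ d f (suc n) - Δ^ d f n         ≡⟨ cong₂ _-_ (holds F (suc n) (ℕ.m≤n⇒m≤1+n N≤n)) (holds F n N≤n) ⟩
    v - v                             ≡⟨ ℚ.+-inverseʳ v ⟩
    0ℚ                                ∎

  later : ∀ {d N N′ f v} → N ≤ N′ → ConstDiff d N f v → ConstDiff d N′ f v
  later N≤N′ F = constDiff λ n N′≤n → holds F n (ℕ.≤-trans N≤N′ N′≤n)

  extend : ∀ {d N f g v} → AgreeFrom N f g → ConstDiff d N g v → ConstDiff d N f v
  extend {d} eq G = constDiff λ n N≤n → trans (Δ^-agree d eq n N≤n) (holds G n N≤n)

  next : ∀ {d N f h v} → AgreeFrom N (λ n → f (suc n)) h → ConstDiff d N h v → ConstDiff d (suc N) f v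
  next {d} {f = f} eq H = constDiff λ where
    (suc n) (ℕ.s≤s N≤n) → trans (sym (Δ^-shift d f n)) (holds (extend eq H) n N≤n)

  integrate : ∀ {d N f h v} → AgreeFrom N (Δ f) h → ConstDiff d N h v → ConstDiff (suc d) N f v
  integrate eq H = constDiff (holds (extend eq H))

  add-vanishing : ∀ {d N f g v} → ConstDiff d N f v → ConstDiff d N g 0ℚ → ConstDiff d N (f +ₛ g) v
  add-vanishing {d} {N} {v = v} F G = subst (ConstDiff d N _) (ℚ.+-identityʳ v) (add F G)

module Polynomials where

  open import Defs
  open import Data.Nat as ℕ using (ℕ; suc; _≤_)
  import Data.Nat.Properties as ℕ
  open import Data.Rational using (ℚ; 0ℚ; _+_; _*_)
  import Data.Rational.Properties as ℚ
  open import Data.Rational.Solver using (module +-*-Solver)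
  open +-*-Solver using (solve; _:+_; _:*_; _:=_; con)
  open import Data.List using (List; []; _∷_; _++_; [_]; length; map)
  open import Data.List.Properties using (length-++; length-map; map-++)
  open import Data.Product using (Σ; _×_; _,_)
  open import Relation.Binary.PropositionalEquality hiding ([_])
  open ≡-Reasoning

  infixl 6 _⊕_
  _⊕_ : Poly → Poly → Poly
  [] ⊕ q = q
  (a ∷ p) ⊕ [] = a ∷ p
  (a ∷ p) ⊕ (b ∷ q) = (a + b) ∷ (p ⊕ q)

  scale : ℚ → Poly → Poly
  scale c = map (c *_)

  mulLinear : Poly → ℚ → ℚ → Poly
  mulLinear p a b = scale a p ⊕ (0ℚ ∷ scale b p)

  eval-⊕ : ∀ p q x → eval (p ⊕ q) x ≡ eval p x + eval q x
  eval-⊕ [] q x = sym (ℚ.+-identityˡ (eval q x))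
  eval-⊕ (a ∷ p) [] x = sym (ℚ.+-identityʳ (a + x * eval p x))
  eval-⊕ (a ∷ p) (b ∷ q) x = begin
    (a + b) + x * eval (p ⊕ q) x              ≡⟨ cong (λ z → (a + b) + x * z) (eval-⊕ p q x) ⟩
    (a + b) + x * (eval p x + eval q x)       ≡⟨ solve 5 (λ a b x e f → (a :+ b) :+ x :* (e :+ f) := (a :+ x :* e) :+ (b :+ x :* f)) refl a b x (eval p x) (eval q x) ⟩
    (a + x * eval p x) + (b + x * eval q x)   ∎

  eval-scale : ∀ c p x → eval (scale c p) x ≡ c * eval p x
  eval-scale c [] x = sym (ℚ.*-zeroʳ c)
  eval-scale c (a ∷ p) x = begin
    c * a + x * eval (scale c p) x   ≡⟨ cong (λ z → c * a + x * z) (eval-scale c p x) ⟩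
    c * a + x * (c * eval p x)       ≡⟨ solve 4 (λ c a x e → c :* a :+ x :* (c :* e) := c :* (a :+ x :* e)) refl c a x (eval p x) ⟩
    c * (a + x * eval p x)           ∎

  eval-mulLinear : ∀ p a b x → eval (mulLinear p a b) x ≡ eval p x * (a + b * x)
  eval-mulLinear p a b x = begin
    eval (scale a p ⊕ (0ℚ ∷ scale b p)) x           ≡⟨ eval-⊕ (scale a p) (0ℚ ∷ scale b p) x ⟩
    eval (scale a p) x + (0ℚ + x * eval (scale b p) x)
        ≡⟨ cong₂ (λ u w → u + (0ℚ + x * w)) (eval-scale a p x) (eval-scale b p x) ⟩
    a * eval p x + (0ℚ + x * (b * eval p x))         ≡⟨ solve 4 (λ e a b x → a :* e :+ (con 0ℚ :+ x :* (b :* e)) := e :* (a :+ b :* x)) refl (eval p x) a b x ⟩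
    eval p x * (a + b * x)                           ∎

  LeadsWith : Poly → ℕ → ℚ → Set
  LeadsWith p m a = Σ (List ℚ) λ as → (p ≡ as ++ [ a ]) × (length as ≡ m)

  ⊕-++ : ∀ p as a → length p ≤ length as → p ⊕ (as ++ [ a ]) ≡ (p ⊕ as) ++ [ a ]
  ⊕-++ [] as a le = refl
  ⊕-++ (c ∷ p) (b ∷ as) a (ℕ.s≤s le) = cong ((c + b) ∷_) (⊕-++ p as a le)

  length-⊕ : ∀ p as → length p ≤ length as → length (p ⊕ as) ≡ length as
  length-⊕ [] as le = refl
  length-⊕ (c ∷ p) (b ∷ as) (ℕ.s≤s le) = cong suc (length-⊕ p as le)

  lead-length : ∀ {p m a} → LeadsWith p m a → length p ≡ suc m
  lead-length {a = a} (as , refl , refl) = trans (length-++ as) (ℕ.+-comm (length as) 1)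

  ⊕-lead : ∀ {p q m a} → length p ≤ m → LeadsWith q m a → LeadsWith (p ⊕ q) m a
  ⊕-lead {p} {a = a} le (as , refl , refl) = p ⊕ as , ⊕-++ p as a le , length-⊕ p as le

  scale-lead : ∀ {p m a} c → LeadsWith p m a → LeadsWith (scale c p) m (c * a)
  scale-lead {a = a} c (as , refl , refl) = scale c as , map-++ (c *_) as [ a ] , length-map (c *_) as

  mulLinear-lead : ∀ {p m e} a b → LeadsWith p m e → LeadsWith (mulLinear p a b) (suc m) (b * e)
  mulLinear-lead {p} {m} {e} a b P with scale-lead b P
  ... | (bs , eq , len) = ⊕-lead shorter (0ℚ ∷ bs , cong (0ℚ ∷_) eq , cong suc len)
    where
    shorter : length (scale a p) ≤ suc m
    shorter = ℕ.≤-reflexive (trans (length-map (a *_) p) (lead-length P))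

module NewtonInterpolation where

  open import Defs
  open import Data.Nat as ℕ using (ℕ; zero; suc)
  import Data.Nat.Properties as ℕ
  open import Data.Rational using (ℚ; 0ℚ; 1ℚ; _+_; _*_; _-_; -_)
  import Data.Rational.Properties as ℚ
  open import Data.Rational.Solver using (module +-*-Solver)
  open +-*-Solver using (solve; _:+_; _:*_; _:-_; :-_; _:=_; con)
  open import Data.List using ([]; _∷_)
  open import Data.Product using (Σ; _×_; _,_)
  open import Relation.Nullary using (¬_)
  open import Relation.Binary.PropositionalEquality
  open ≡-Reasoning
  open NatEmbedding
  open FiniteDifferences
  open Polynomials

  -- The binomial polynomial binom N j, with value C(x - N, j), built from
  -- C(y, j + 1) = C(y, j) · (y - j) / (j + 1).
  binom : ℕ → ℕ → Poly
  binom N zero = 1ℚ ∷ []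
  binom N (suc j) = mulLinear (binom N j) (- (ℕtoℚ (N ℕ.+ j) * recip j)) (recip j)

  β : ℕ → ℕ → ℚ → ℚ
  β N j = eval (binom N j)

  β-zero : ∀ N x → β N 0 x ≡ 1ℚ
  β-zero N x = solve 1 (λ x → con 1ℚ :+ x :* con 0ℚ := con 1ℚ) refl x

  β-suc : ∀ N j x → β N (suc j) x ≡ β N j x * (recip j * (x - ℕtoℚ (N ℕ.+ j)))
  β-suc N j x = trans (eval-mulLinear (binom N j) (- (ℕtoℚ (N ℕ.+ j) * recip j)) (recip j) x)
    (solve 4 (λ e u ρ x → e :* (:- (u :* ρ) :+ ρ :* x) := e :* (ρ :* (x :- u))) refl (β N j x) (ℕtoℚ (N ℕ.+ j)) (recip j) x)

  β-shift : ∀ N j x → β N (suc j) (1ℚ + x) ≡ β N j x * (recip j * ((1ℚ + x) - ℕtoℚ N))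
  β-shift N zero x = begin
    β N 1 (1ℚ + x)
        ≡⟨ β-suc N 0 (1ℚ + x) ⟩
    β N 0 (1ℚ + x) * (recip 0 * ((1ℚ + x) - ℕtoℚ (N ℕ.+ 0)))
        ≡⟨ cong₂ (λ b n → b * (recip 0 * ((1ℚ + x) - ℕtoℚ n))) (trans (β-zero N (1ℚ + x)) (sym (β-zero N x))) (ℕ.+-identityʳ N) ⟩
    β N 0 x * (recip 0 * ((1ℚ + x) - ℕtoℚ N)) ∎
  β-shift N (suc j) x = begin
    β N (suc (suc j)) (1ℚ + x)
        ≡⟨ β-suc N (suc j) (1ℚ + x) ⟩
    β N (suc j) (1ℚ + x) * (R * ((1ℚ + x) - ℕtoℚ (N ℕ.+ suc j)))
        ≡⟨ cong₂ (λ b u → b * (R * ((1ℚ + x) - u))) (β-shift N j x) (trans (cong ℕtoℚ (ℕ.+-suc N j)) (ℕtoℚ-suc (N ℕ.+ j))) ⟩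
    (β N j x * (ρ * ((1ℚ + x) - n))) * (R * ((1ℚ + x) - (1ℚ + u)))
        ≡⟨ solve 6 (λ b ρ R x n u → (b :* (ρ :* ((con 1ℚ :+ x) :- n))) :* (R :* ((con 1ℚ :+ x) :- (con 1ℚ :+ u)))
                                 := (b :* (ρ :* (x :- u))) :* (R :* ((con 1ℚ :+ x) :- n))) refl (β N j x) ρ R x n u ⟩
    (β N j x * (ρ * (x - u))) * (R * ((1ℚ + x) - n))
        ≡⟨ cong (_* (R * ((1ℚ + x) - n))) (sym (β-suc N j x)) ⟩
    β N (suc j) x * (R * ((1ℚ + x) - n)) ∎
    where
    ρ = recip j
    R = recip (suc j)
    n = ℕtoℚ N
    u = ℕtoℚ (N ℕ.+ j)

  pascal : ∀ N j x → β N (suc j) (1ℚ + x) ≡ β N (suc j) x + β N j x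
  pascal N j x = begin
    β N (suc j) (1ℚ + x)                          ≡⟨ β-shift N j x ⟩
    b * (ρ * ((1ℚ + x) - n))                      ≡⟨ solve 5 (λ b ρ x n k → b :* (ρ :* ((con 1ℚ :+ x) :- n)) := b :* (ρ :* (x :- (n :+ k))) :+ b :* (ρ :* (con 1ℚ :+ k))) refl b ρ x n k ⟩
    b * (ρ * (x - (n + k))) + b * (ρ * (1ℚ + k))  ≡⟨ cong₂ (λ u w → b * (ρ * (x - u)) + b * w) (sym (ℕtoℚ-+ N j)) (trans (cong (ρ *_) (sym (ℕtoℚ-suc j))) (recip-inverse j)) ⟩
    b * (ρ * (x - ℕtoℚ (N ℕ.+ j))) + b * 1ℚ      ≡⟨ cong₂ _+_ (sym (β-suc N j x)) (ℚ.*-identityʳ b) ⟩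
    β N (suc j) x + b                             ∎
    where
    b = β N j x
    ρ = recip j
    n = ℕtoℚ N
    k = ℕtoℚ j

  β-root : ∀ N j → β N (suc j) (ℕtoℚ N) ≡ 0ℚ
  β-root N zero = begin
    β N 1 (ℕtoℚ N)                                            ≡⟨ β-suc N 0 (ℕtoℚ N) ⟩
    β N 0 (ℕtoℚ N) * (recip 0 * (ℕtoℚ N - ℕtoℚ (N ℕ.+ 0)))  ≡⟨ cong (λ m → β N 0 (ℕtoℚ N) * (recip 0 * (ℕtoℚ N - ℕtoℚ m))) (ℕ.+-identityʳ N) ⟩
    β N 0 (ℕtoℚ N) * (recip 0 * (ℕtoℚ N - ℕtoℚ N))         ≡⟨ solve 3 (λ b ρ a → b :* (ρ :* (a :- a)) := con 0ℚ) refl (β N 0 (ℕtoℚ N)) (recip 0) (ℕtoℚ N) ⟩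
    0ℚ ∎
  β-root N (suc j) = trans (β-suc N (suc j) (ℕtoℚ N)) (trans (cong (_* step) (β-root N j)) (ℚ.*-zeroˡ step))
    where step = recip (suc j) * (ℕtoℚ N - ℕtoℚ (N ℕ.+ suc j))

  invFact : ℕ → ℚ
  invFact zero = 1ℚ
  invFact (suc j) = recip j * invFact j

  binom-lead : ∀ N j → LeadsWith (binom N j) j (invFact j)
  binom-lead N zero = [] , refl , refl
  binom-lead N (suc j) = mulLinear-lead (- (ℕtoℚ (N ℕ.+ j) * recip j)) (recip j) (binom-lead N j)

  invFact-cancel : ∀ v j → v * invFact j ≡ 0ℚ → v ≡ 0ℚ
  invFact-cancel v j eq = begin
    v                                  ≡⟨ sym (ℚ.*-identityʳ v) ⟩
    v * 1ℚ                             ≡⟨ cong (v *_) (sym (invFact-fact j)) ⟩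
    v * (invFact j * fact j)           ≡⟨ sym (ℚ.*-assoc v (invFact j) (fact j)) ⟩
    (v * invFact j) * fact j           ≡⟨ cong (_* fact j) eq ⟩
    0ℚ * fact j                        ≡⟨ ℚ.*-zeroˡ (fact j) ⟩
    0ℚ                                 ∎
    where
    fact : ℕ → ℚ
    fact zero = 1ℚ
    fact (suc j) = ℕtoℚ (suc j) * fact j
    invFact-fact : ∀ j → invFact j * fact j ≡ 1ℚ
    invFact-fact zero = refl
    invFact-fact (suc j) = begin
      (recip j * invFact j) * (ℕtoℚ (suc j) * fact j)   ≡⟨ solve 4 (λ a b c e → (a :* b) :* (c :* e) := (a :* c) :* (b :* e)) refl (recip j) (invFact j) (ℕtoℚ (suc j)) (fact j) ⟩
      (recip j * ℕtoℚ (suc j)) * (invFact j * fact j)   ≡⟨ cong₂ _*_ (recip-inverse j) (invFact-fact j) ⟩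
      1ℚ                                                 ∎

  newton : ℕ → ℕ → Seq → Poly
  newton N zero f = scale (f N) (binom N 0)
  newton N (suc d) f = newton N d f ⊕ scale (Δ^ (suc d) f N) (binom N (suc d))

  ν : ℕ → ℕ → Seq → ℚ → ℚ
  ν N d f = eval (newton N d f)

  ν-suc : ∀ N d f x → ν N (suc d) f x ≡ ν N d f x + Δ^ (suc d) f N * β N (suc d) x
  ν-suc N d f x = trans (eval-⊕ (newton N d f) _ x) (cong (ν N d f x +_) (eval-scale (Δ^ (suc d) f N) (binom N (suc d)) x))

  ν-zero : ∀ N f x → ν N 0 f x ≡ f N
  ν-zero N f x = trans (eval-scale (f N) (binom N 0) x) (trans (cong (f N *_) (β-zero N x)) (ℚ.*-identityʳ (f N)))

  ν-step : ∀ N d f x → ν N (suc d) f (1ℚ + x) ≡ ν N (suc d) f x + ν N d (Δ f) x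
  ν-step N zero f x = begin
    ν N 1 f (1ℚ + x)                               ≡⟨ ν-suc N 0 f (1ℚ + x) ⟩
    ν N 0 f (1ℚ + x) + c * β N 1 (1ℚ + x)          ≡⟨ cong₂ (λ u w → u + c * w) (ν-zero N f (1ℚ + x)) (pascal N 0 x) ⟩
    f N + c * (β N 1 x + β N 0 x)                  ≡⟨ cong (λ w → f N + c * (β N 1 x + w)) (β-zero N x) ⟩
    f N + c * (β N 1 x + 1ℚ)                       ≡⟨ solve 3 (λ a c b → a :+ c :* (b :+ con 1ℚ) := (a :+ c :* b) :+ c) refl (f N) c (β N 1 x) ⟩
    (f N + c * β N 1 x) + c                        ≡⟨ cong₂ (λ u w → (u + c * β N 1 x) + w) (sym (ν-zero N f x)) (sym (ν-zero N (Δ f) x)) ⟩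
    (ν N 0 f x + c * β N 1 x) + ν N 0 (Δ f) x      ≡⟨ cong (_+ ν N 0 (Δ f) x) (sym (ν-suc N 0 f x)) ⟩
    ν N 1 f x + ν N 0 (Δ f) x                      ∎
    where
    c = Δ f N
  ν-step N (suc d) f x = begin
    ν N (suc (suc d)) f (1ℚ + x)
        ≡⟨ ν-suc N (suc d) f (1ℚ + x) ⟩
    ν N (suc d) f (1ℚ + x) + c * β N (suc (suc d)) (1ℚ + x)
        ≡⟨ cong₂ (λ u w → u + c * w) (ν-step N d f x) (pascal N (suc d) x) ⟩
    (ν N (suc d) f x + ν N d (Δ f) x) + c * (β N (suc (suc d)) x + β N (suc d) x)
        ≡⟨ solve 5 (λ a b c e g → (a :+ b) :+ c :* (e :+ g) := (a :+ c :* e) :+ (b :+ c :* g)) refl (ν N (suc d) f x) (ν N d (Δ f) x) c (β N (suc (suc d)) x) (β N (suc d) x) ⟩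
    (ν N (suc d) f x + c * β N (suc (suc d)) x) + (ν N d (Δ f) x + c * β N (suc d) x)
        ≡⟨ cong₂ _+_ (sym (ν-suc N (suc d) f x)) (sym (ν-suc N d (Δ f) x)) ⟩
    ν N (suc (suc d)) f x + ν N (suc d) (Δ f) x ∎
    where
    c = Δ^ (suc (suc d)) f N

  ν-base : ∀ N d f → ν N d f (ℕtoℚ N) ≡ f N
  ν-base N zero f = ν-zero N f (ℕtoℚ N)
  ν-base N (suc d) f = begin
    ν N (suc d) f (ℕtoℚ N)                            ≡⟨ ν-suc N d f (ℕtoℚ N) ⟩
    ν N d f (ℕtoℚ N) + c * β N (suc d) (ℕtoℚ N)       ≡⟨ cong₂ (λ u w → u + c * w) (ν-base N d f) (β-root N d) ⟩
    f N + c * 0ℚ                                      ≡⟨ cong (f N +_) (ℚ.*-zeroʳ c) ⟩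
    f N + 0ℚ                                          ≡⟨ ℚ.+-identityʳ (f N) ⟩
    f N                                               ∎
    where
    c = Δ^ (suc d) f N

  newton-formula : ∀ {d N f v} → ConstDiff d N f v → ∀ m → f (N ℕ.+ m) ≡ ν N d f (ℕtoℚ (N ℕ.+ m))
  newton-formula {zero} {N} {f} F m = begin
    f (N ℕ.+ m)                 ≡⟨ holds F (N ℕ.+ m) (ℕ.m≤m+n N m) ⟩
    _                           ≡⟨ sym (holds F N ℕ.≤-refl) ⟩
    f N                         ≡⟨ sym (ν-zero N f (ℕtoℚ (N ℕ.+ m))) ⟩
    ν N 0 f (ℕtoℚ (N ℕ.+ m))    ∎
  newton-formula {suc d} {N} {f} {v} F = go
    where
    -- Δ^(d+1) f = Δ^d (Δ f), so Δ f has constant d-th difference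
    ΔF : ConstDiff d N (Δ f) v
    ΔF = constDiff (holds F)
    go : ∀ m → f (N ℕ.+ m) ≡ ν N (suc d) f (ℕtoℚ (N ℕ.+ m))
    go zero = subst (λ n → f n ≡ ν N (suc d) f (ℕtoℚ n)) (sym (ℕ.+-identityʳ N)) (sym (ν-base N (suc d) f))
    go (suc m) = subst (λ n → f n ≡ ν N (suc d) f (ℕtoℚ n)) (sym (ℕ.+-suc N m)) (begin
      f (suc n)                                 ≡⟨ solve 2 (λ a b → a := b :+ (a :- b)) refl (f (suc n)) (f n) ⟩
      f n + Δ f n                               ≡⟨ cong₂ _+_ (go m) (newton-formula ΔF m) ⟩
      ν N (suc d) f x + ν N d (Δ f) x           ≡⟨ sym (ν-step N d f x) ⟩
      ν N (suc d) f (1ℚ + x)                    ≡⟨ cong (ν N (suc d) f) (sym (ℕtoℚ-suc n)) ⟩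
      ν N (suc d) f (ℕtoℚ (suc n))              ∎)
      where
      n = N ℕ.+ m
      x = ℕtoℚ n

  newton-lead : ∀ N d f → LeadsWith (newton N d f) d (Δ^ d f N * invFact d)
  newton-lead N zero f = scale-lead (f N) (binom-lead N 0)
  newton-lead N (suc d) f = ⊕-lead (ℕ.≤-reflexive (lead-length (newton-lead N d f))) (scale-lead (Δ^ (suc d) f N) (binom-lead N (suc d)))

  PolynomialFrom : ℕ → Seq → ℕ → Set
  PolynomialFrom N f d = Σ Poly λ p → AgreeFrom N f (λ n → eval p (ℕtoℚ n)) × HasDegree p d

  eventually-polynomial : ∀ {d N f v} → ConstDiff d N f v → ¬ (v ≡ 0ℚ) → PolynomialFrom N f d
  eventually-polynomial {d} {N} {f} {v} F v≢0 with newton-lead N d f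
  ... | (as , eq , len) = newton N d f , agree , (as , _ , eq , len , lead≢0)
    where
    agree : AgreeFrom N f (λ n → ν N d f (ℕtoℚ n))
    agree n N≤n with ℕ.m≤n⇒∃[o]m+o≡n N≤n
    ... | (m , refl) = newton-formula F m
    lead≢0 : ¬ (Δ^ d f N * invFact d ≡ 0ℚ)
    lead≢0 eq = v≢0 (trans (sym (holds F N ℕ.≤-refl)) (invFact-cancel _ d eq))

module FiniteSums where

  open import Data.Bool using (Bool; true; false)
  open import Data.Nat using (ℕ; suc; _+_)
  import Data.Nat.Properties as ℕ
  open import Data.List using (List; []; _∷_; _++_; concatMap; map; filterᵇ; length)
  open import Relation.Binary.PropositionalEquality
  open import Algebra.Properties.CommutativeSemigroup ℕ.+-commutativeSemigroup using () renaming (interchange to +-interchange)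


  sumOver : {A : Set} → (A → ℕ) → List A → ℕ
  sumOver f [] = 0
  sumOver f (x ∷ xs) = f x + sumOver f xs

  indicator : Bool → ℕ
  indicator true = 1
  indicator false = 0

  length-filter : {A : Set} (Q : A → Bool) (xs : List A) → length (filterᵇ Q xs) ≡ sumOver (λ x → indicator (Q x)) xs
  length-filter Q [] = refl
  length-filter Q (x ∷ xs) with Q x
  ... | true = cong suc (length-filter Q xs)
  ... | false = length-filter Q xs

  sumOver-++ : {A : Set} (f : A → ℕ) (xs ys : List A) → sumOver f (xs ++ ys) ≡ sumOver f xs + sumOver f ys
  sumOver-++ f [] ys = refl
  sumOver-++ f (x ∷ xs) ys = trans (cong (f x +_) (sumOver-++ f xs ys)) (sym (ℕ.+-assoc (f x) (sumOver f xs) (sumOver f ys)))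

  sumOver-concatMap : {A B : Set} (f : B → ℕ) (F : A → List B) (xs : List A) →
    sumOver f (concatMap F xs) ≡ sumOver (λ x → sumOver f (F x)) xs
  sumOver-concatMap f F [] = refl
  sumOver-concatMap f F (x ∷ xs) = trans (sumOver-++ f (F x) (concatMap F xs)) (cong (sumOver f (F x) +_) (sumOver-concatMap f F xs))

  sumOver-map : {A B : Set} (f : B → ℕ) (g : A → B) (xs : List A) → sumOver f (map g xs) ≡ sumOver (λ x → f (g x)) xs
  sumOver-map f g [] = refl
  sumOver-map f g (x ∷ xs) = cong (f (g x) +_) (sumOver-map f g xs)

  sumOver-cong : {A : Set} {f g : A → ℕ} (xs : List A) → (∀ x → f x ≡ g x) → sumOver f xs ≡ sumOver g xs
  sumOver-cong [] eq = refl
  sumOver-cong (x ∷ xs) eq = cong₂ _+_ (eq x) (sumOver-cong xs eq)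

  sumOver-zero : {A : Set} (xs : List A) → sumOver (λ _ → 0) xs ≡ 0
  sumOver-zero [] = refl
  sumOver-zero (x ∷ xs) = sumOver-zero xs

  sumOver-+ : {A : Set} (f g : A → ℕ) (xs : List A) → sumOver (λ x → f x + g x) xs ≡ sumOver f xs + sumOver g xs
  sumOver-+ f g [] = refl
  sumOver-+ f g (x ∷ xs) = trans (cong (f x + g x +_) (sumOver-+ f g xs)) (+-interchange (f x) (g x) (sumOver f xs) (sumOver g xs))

  sumOver-swap : {A B : Set} (F : A → B → ℕ) (xs : List A) (ys : List B) →
    sumOver (λ x → sumOver (F x) ys) xs ≡ sumOver (λ y → sumOver (λ x → F x y) xs) ys
  sumOver-swap F [] ys = sym (sumOver-zero ys)
  sumOver-swap F (x ∷ xs) ys = trans (cong (sumOver (F x) ys +_) (sumOver-swap F xs ys))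
                                     (sym (sumOver-+ (F x) (λ y → sumOver (λ x → F x y) xs) ys))

module GridCounting where

  open import Defs
  open import Data.Bool using (Bool; true; false; _∧_; if_then_else_)
  import Data.Bool.Properties as Bool
  open import Data.Nat using (ℕ; zero; suc; _+_; _∸_; _≡ᵇ_; _≤ᵇ_; _<ᵇ_)
  import Data.Nat.Properties as ℕ
  open import Data.List using ([]; _∷_; concatMap; map; filterᵇ; length)
  open import Data.Vec using ([]; _∷_; _∷ʳ_)
  open import Data.Maybe using (just)
  open import Relation.Binary.PropositionalEquality
  open FiniteSums

  count : (n : ℕ) → (Grid n → Bool) → ℕ
  count zero Q = indicator (Q [])
  count (suc n) Q = sumOver (λ c → count n (λ g → Q (c ∷ g))) allColumns

  count-cong : ∀ n {Q Q′ : Grid n → Bool} → (∀ g → Q g ≡ Q′ g) → count n Q ≡ count n Q′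
  count-cong zero eq = cong indicator (eq [])
  count-cong (suc n) eq = sumOver-cong allColumns (λ c → count-cong n (λ g → eq (c ∷ g)))

  count-allGrids : ∀ n (Q : Grid n → Bool) → length (filterᵇ Q (allGrids n)) ≡ count n Q
  count-allGrids zero Q = trans (length-filter Q ([] ∷ [])) (ℕ.+-identityʳ (indicator (Q [])))
  count-allGrids (suc n) Q = begin
    length (filterᵇ Q (allGrids (suc n)))
      ≡⟨ length-filter Q (allGrids (suc n)) ⟩
    sumOver (λ g → indicator (Q g)) (concatMap (λ g → map (_∷ g) allColumns) (allGrids n))
      ≡⟨ sumOver-concatMap (λ g → indicator (Q g)) (λ g → map (_∷ g) allColumns) (allGrids n) ⟩
    sumOver (λ g → sumOver (λ g′ → indicator (Q g′)) (map (_∷ g) allColumns)) (allGrids n)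
      ≡⟨ sumOver-cong (allGrids n) (λ g → sumOver-map (λ g′ → indicator (Q g′)) (_∷ g) allColumns) ⟩
    sumOver (λ g → sumOver (λ c → indicator (Q (c ∷ g))) allColumns) (allGrids n)
      ≡⟨ sumOver-swap (λ g c → indicator (Q (c ∷ g))) (allGrids n) allColumns ⟩
    sumOver (λ c → sumOver (λ g → indicator (Q (c ∷ g))) (allGrids n)) allColumns
      ≡⟨ sumOver-cong allColumns (λ c → trans (sym (length-filter (λ g → Q (c ∷ g)) (allGrids n))) (count-allGrids n (λ g → Q (c ∷ g)))) ⟩
    count (suc n) Q ∎
    where open ≡-Reasoning

  count-snoc : ∀ n (Q : Grid (suc n) → Bool) → count (suc n) Q ≡ sumOver (λ d → count n (λ g → Q (g ∷ʳ d))) allColumns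
  count-snoc zero Q = refl
  count-snoc (suc n) Q =
    trans (sumOver-cong allColumns (λ c → count-snoc n (λ g → Q (c ∷ g))))
          (sumOver-swap (λ c d → count n (λ g → Q (c ∷ (g ∷ʳ d)))) allColumns allColumns)

  count-guard : ∀ n b (Q : Grid n → Bool) → count n (λ g → b ∧ Q g) ≡ (if b then count n Q else 0)
  count-guard n true Q = refl
  count-guard zero false Q = refl
  count-guard (suc n) false Q = trans (sumOver-cong allColumns (λ c → count-guard n false (λ g → Q (c ∷ g)))) (sumOver-zero allColumns)

  lastOf : ∀ {n} → Grid (suc n) → Column
  lastOf (c ∷ []) = c
  lastOf (c ∷ d ∷ g) = lastOf (d ∷ g)

  lastOf-snoc : ∀ {n} (g : Grid n) d → lastOf (g ∷ʳ d) ≡ d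
  lastOf-snoc [] d = refl
  lastOf-snoc (c ∷ []) d = refl
  lastOf-snoc (c ∷ c′ ∷ g) d = lastOf-snoc (c′ ∷ g) d

  lastColumn-snoc : ∀ {n} (g : Grid n) d → lastColumn (g ∷ʳ d) ≡ just d
  lastColumn-snoc [] d = refl
  lastColumn-snoc (c ∷ []) d = refl
  lastColumn-snoc (c ∷ c′ ∷ g) d = lastColumn-snoc (c′ ∷ g) d

  independent-snoc : ∀ {n} (g : Grid (suc n)) d → independent (g ∷ʳ d) ≡ independent g ∧ adjOK (lastOf g) d ∧ colOK d
  independent-snoc (c ∷ []) d = refl
  independent-snoc (c ∷ c′ ∷ g) d = begin
    colOK c ∧ adjOK c c′ ∧ independent ((c′ ∷ g) ∷ʳ d)
      ≡⟨ cong (λ b → colOK c ∧ adjOK c c′ ∧ b) (independent-snoc (c′ ∷ g) d) ⟩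
    colOK c ∧ adjOK c c′ ∧ (independent (c′ ∷ g) ∧ rest)
      ≡⟨ cong (colOK c ∧_) (sym (Bool.∧-assoc (adjOK c c′) (independent (c′ ∷ g)) rest)) ⟩
    colOK c ∧ (adjOK c c′ ∧ independent (c′ ∷ g)) ∧ rest
      ≡⟨ sym (Bool.∧-assoc (colOK c) (adjOK c c′ ∧ independent (c′ ∷ g)) rest) ⟩
    (colOK c ∧ adjOK c c′ ∧ independent (c′ ∷ g)) ∧ rest ∎
    where
    open ≡-Reasoning
    rest = adjOK (lastOf (c′ ∷ g)) d ∧ colOK d

  weight-snoc : ∀ {n} (g : Grid n) d → weight (g ∷ʳ d) ≡ weight g + colWeight d
  weight-snoc [] d = ℕ.+-identityʳ (colWeight d)
  weight-snoc (c ∷ g) d = trans (cong (colWeight c +_) (weight-snoc g d)) (sym (ℕ.+-assoc (colWeight c) (weight g) (colWeight d)))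

  +-≡ᵇ-split : ∀ W c k → (W + c ≡ᵇ k) ≡ (c ≤ᵇ k) ∧ (W ≡ᵇ k ∸ c)
  +-≡ᵇ-split W zero k = cong (_≡ᵇ k) (ℕ.+-identityʳ W)
  +-≡ᵇ-split W (suc c) zero = cong (_≡ᵇ 0) (ℕ.+-suc W c)
  +-≡ᵇ-split W (suc c) (suc k) = trans (cong (_≡ᵇ suc k) (ℕ.+-suc W c)) (trans (+-≡ᵇ-split W c k) (cong (_∧ (W ≡ᵇ k ∸ c)) (sym (<ᵇ-suc c k))))
    where
    <ᵇ-suc : ∀ c k → (c <ᵇ suc k) ≡ (c ≤ᵇ k)
    <ᵇ-suc zero k = refl
    <ᵇ-suc (suc c) k = refl

  swap-middle : ∀ a b c e → (a ∧ b) ∧ (c ∧ e) ≡ (b ∧ c) ∧ (a ∧ e)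
  swap-middle true true true e = refl
  swap-middle true true false e = refl
  swap-middle true false c e = refl
  swap-middle false false c e = refl
  swap-middle false true false e = refl
  swap-middle false true true e = refl

  follows : ℕ → Column → Column → Bool
  follows k d′ d = (adjOK d′ d ∧ colOK d) ∧ (colWeight d ≤ᵇ k)

  -- The transfer-matrix count: ending m k d is the number of k-selections of
  -- the 3 × (m + 1) grid whose last column is d (proved in ending-count).  It
  -- is defined by recursion on m: the previous column d′ ends a selection of
  -- weight k - |d|.
  ending : ℕ → ℕ → Column → ℕ
  ending zero k d = indicator (colOK d ∧ (colWeight d + 0 ≡ᵇ k))
  ending (suc m) k d = sumOver (λ d′ → if follows k d′ d then ending m (k ∸ colWeight d) d′ else 0) allColumns

  selection-snoc : ∀ {m} (h : Grid m) d′ d k →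
    independent (h ∷ʳ d′ ∷ʳ d) ∧ (weight (h ∷ʳ d′ ∷ʳ d) ≡ᵇ k)
      ≡ follows k d′ d ∧ (independent (h ∷ʳ d′) ∧ (weight (h ∷ʳ d′) ≡ᵇ k ∸ colWeight d))
  selection-snoc h d′ d k
    rewrite independent-snoc (h ∷ʳ d′) d | lastOf-snoc h d′ | weight-snoc (h ∷ʳ d′) d | +-≡ᵇ-split (weight (h ∷ʳ d′)) (colWeight d) k
    = swap-middle (independent (h ∷ʳ d′)) (adjOK d′ d ∧ colOK d) (colWeight d ≤ᵇ k) (weight (h ∷ʳ d′) ≡ᵇ k ∸ colWeight d)

  ending-count : ∀ m k d → count m (λ g → independent (g ∷ʳ d) ∧ (weight (g ∷ʳ d) ≡ᵇ k)) ≡ ending m k d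
  ending-count zero k d = refl
  ending-count (suc m) k d =
    trans (count-snoc m (λ g → independent (g ∷ʳ d) ∧ (weight (g ∷ʳ d) ≡ᵇ k)))
          (sumOver-cong allColumns λ d′ → begin
            count m (λ h → independent (h ∷ʳ d′ ∷ʳ d) ∧ (weight (h ∷ʳ d′ ∷ʳ d) ≡ᵇ k))
              ≡⟨ count-cong m (λ h → selection-snoc h d′ d k) ⟩
            count m (λ h → follows k d′ d ∧ (independent (h ∷ʳ d′) ∧ (weight (h ∷ʳ d′) ≡ᵇ k ∸ colWeight d)))
              ≡⟨ count-guard m (follows k d′ d) _ ⟩
            (if follows k d′ d then count m (λ h → independent (h ∷ʳ d′) ∧ (weight (h ∷ʳ d′) ≡ᵇ k ∸ colWeight d)) else 0)
              ≡⟨ cong (if follows k d′ d then_else 0) (ending-count m (k ∸ colWeight d) d′) ⟩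
            (if follows k d′ d then ending m (k ∸ colWeight d) d′ else 0) ∎)
    where open ≡-Reasoning

module TransferRecurrences where

  open import Defs
  open import Data.Bool using (Bool; true; false; _∧_; if_then_else_)
  import Data.Bool.Properties as Bool
  open import Data.Nat using (ℕ; zero; suc; _+_; _≡ᵇ_)
  import Data.Nat.Properties as ℕ
  open import Data.Vec using ([]; _∷_; _∷ʳ_)
  open import Relation.Binary.PropositionalEquality
  open import Data.Nat.Solver using (module +-*-Solver)
  open +-*-Solver using (solve; _:+_; _:=_; con)
  open FiniteSums
  open GridCounting

  -- the five columns without vertically adjacent squares
  empty top center bottom topBottom : Column
  empty     = false ∷ false ∷ false ∷ []
  top       = true  ∷ false ∷ false ∷ []
  center    = false ∷ true  ∷ false ∷ []
  bottom    = false ∷ false ∷ true  ∷ []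
  topBottom = true  ∷ false ∷ true  ∷ []

  countSel-ending : (P : ∀ {n} → Grid n → Bool) (Pc : Column → Bool) →
    (∀ {n} (g : Grid n) d → P (g ∷ʳ d) ≡ Pc d) →
    ∀ m k → countSel P (suc m) k ≡ sumOver (λ d → if Pc d then ending m k d else 0) allColumns
  countSel-ending P Pc P-last m k = begin
    countSel P (suc m) k
      ≡⟨ count-allGrids (suc m) selected ⟩
    count (suc m) selected
      ≡⟨ count-snoc m selected ⟩
    sumOver (λ d → count m (λ g → selected (g ∷ʳ d))) allColumns
      ≡⟨ sumOver-cong allColumns (λ d → count-cong m (λ g → reorder g d)) ⟩
    sumOver (λ d → count m (λ g → Pc d ∧ (independent (g ∷ʳ d) ∧ (weight (g ∷ʳ d) ≡ᵇ k)))) allColumns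
      ≡⟨ sumOver-cong allColumns (λ d → trans (count-guard m (Pc d) _) (cong (if Pc d then_else 0) (ending-count m k d))) ⟩
    sumOver (λ d → if Pc d then ending m k d else 0) allColumns ∎
    where
    open ≡-Reasoning
    selected : Grid (suc m) → Bool
    selected g = independent g ∧ (weight g ≡ᵇ k) ∧ P g
    reorder : ∀ g d → selected (g ∷ʳ d) ≡ Pc d ∧ (independent (g ∷ʳ d) ∧ (weight (g ∷ʳ d) ≡ᵇ k))
    reorder g d = begin
      independent (g ∷ʳ d) ∧ (weight (g ∷ʳ d) ≡ᵇ k) ∧ P (g ∷ʳ d)   ≡⟨ cong (λ b → independent (g ∷ʳ d) ∧ (weight (g ∷ʳ d) ≡ᵇ k) ∧ b) (P-last g d) ⟩
      independent (g ∷ʳ d) ∧ (weight (g ∷ʳ d) ≡ᵇ k) ∧ Pc d          ≡⟨ sym (Bool.∧-assoc (independent (g ∷ʳ d)) _ (Pc d)) ⟩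
      (independent (g ∷ʳ d) ∧ (weight (g ∷ʳ d) ≡ᵇ k)) ∧ Pc d        ≡⟨ Bool.∧-comm _ (Pc d) ⟩
      Pc d ∧ (independent (g ∷ʳ d) ∧ (weight (g ∷ʳ d) ≡ᵇ k))        ∎

  isBottom isCenter : Column → Bool
  isBottom (false ∷ false ∷ true ∷ []) = true
  isBottom _ = false
  isCenter (false ∷ true ∷ false ∷ []) = true
  isCenter _ = false

  lastIsBottom-snoc : ∀ {n} (g : Grid n) d → lastIsBottom (g ∷ʳ d) ≡ isBottom d
  lastIsBottom-snoc g (a ∷ b ∷ c ∷ []) rewrite lastColumn-snoc g (a ∷ b ∷ c ∷ []) with a | b | c
  ... | true | _ | _ = refl
  ... | false | true | _ = refl
  ... | false | false | true = refl
  ... | false | false | false = refl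

  lastIsCenter-snoc : ∀ {n} (g : Grid n) d → lastIsCenter (g ∷ʳ d) ≡ isCenter d
  lastIsCenter-snoc g (a ∷ b ∷ c ∷ []) rewrite lastColumn-snoc g (a ∷ b ∷ c ∷ []) with a | b | c
  ... | true | _ | _ = refl
  ... | false | true | true = refl
  ... | false | true | false = refl
  ... | false | false | _ = refl

  lastHasTwo-snoc : ∀ {n} (g : Grid n) d → lastHasTwo (g ∷ʳ d) ≡ (colWeight d ≡ᵇ 2)
  lastHasTwo-snoc g d rewrite lastColumn-snoc g d = refl

  topCenter centerBottom full : Column
  topCenter    = true  ∷ true ∷ false ∷ []
  centerBottom = false ∷ true ∷ true  ∷ []
  full         = true  ∷ true ∷ true  ∷ []

  ending-topCenter : ∀ m k → ending m k topCenter ≡ 0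
  ending-topCenter zero k = refl
  ending-topCenter (suc m) k = refl

  ending-centerBottom : ∀ m k → ending m k centerBottom ≡ 0
  ending-centerBottom zero k = refl
  ending-centerBottom (suc m) k = refl

  ending-full : ∀ m k → ending m k full ≡ 0
  ending-full zero k = refl
  ending-full (suc m) k = refl

  Tb-ending : ∀ m k → Tb (suc m) k ≡ ending m k bottom
  Tb-ending m k = trans (countSel-ending lastIsBottom isBottom lastIsBottom-snoc m k) (ℕ.+-identityʳ (ending m k bottom))

  Tc-ending : ∀ m k → Tc (suc m) k ≡ ending m k center
  Tc-ending m k = trans (countSel-ending lastIsCenter isCenter lastIsCenter-snoc m k) (ℕ.+-identityʳ (ending m k center))

  Td-ending : ∀ m k → Td (suc m) k ≡ ending m k topBottom
  Td-ending m k = begin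
    Td (suc m) k
      ≡⟨ countSel-ending lastHasTwo (λ d → colWeight d ≡ᵇ 2) lastHasTwo-snoc m k ⟩
    ending m k topCenter + (ending m k topBottom + (ending m k centerBottom + 0))
      ≡⟨ cong₂ (λ a b → a + (ending m k topBottom + (b + 0))) (ending-topCenter m k) (ending-centerBottom m k) ⟩
    ending m k topBottom + 0
      ≡⟨ ℕ.+-identityʳ (ending m k topBottom) ⟩
    ending m k topBottom ∎
    where open ≡-Reasoning

  -- all selections: the grid extended by an empty column
  T-ending : ∀ m k → T (suc m) k ≡ ending (suc m) k empty
  T-ending m k = countSel-ending (λ _ → true) (λ _ → true) (λ _ _ → refl) m k

  top-step : ∀ m k → ending (suc m) (suc k) top ≡ (ending m k empty + ending m k center) + ending m k bottom
  top-step m k rewrite ending-centerBottom m k = solve 3 (λ e c b → c :+ (b :+ (e :+ con 0)) := (e :+ c) :+ b) refl (ending m k empty) (ending m k center) (ending m k bottom)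

  bottom-step : ∀ m k → ending (suc m) (suc k) bottom ≡ (ending m k empty + ending m k top) + ending m k center
  bottom-step m k rewrite ending-topCenter m k = solve 3 (λ e t c → t :+ (c :+ (e :+ con 0)) := (e :+ t) :+ c) refl (ending m k empty) (ending m k top) (ending m k center)

  center-step : ∀ m k → ending (suc m) (suc k) center ≡ ((ending m k empty + ending m k top) + ending m k bottom) + ending m k topBottom
  center-step m k = solve 4 (λ e t b d → d :+ (t :+ (b :+ (e :+ con 0))) := ((e :+ t) :+ b) :+ d) refl (ending m k empty) (ending m k top) (ending m k bottom) (ending m k topBottom)

  topBottom-step : ∀ m k → ending (suc m) (suc (suc k)) topBottom ≡ ending m k empty + ending m k center
  topBottom-step m k = solve 2 (λ e c → c :+ (e :+ con 0) := e :+ c) refl (ending m k empty) (ending m k center)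

  empty-step : ∀ m k → ending (suc m) k empty ≡ ending m k empty + (((ending m k top + ending m k center) + ending m k bottom) + ending m k topBottom)
  empty-step m k rewrite ending-topCenter m k | ending-centerBottom m k | ending-full m k =
    solve 5 (λ e t c b d → d :+ (t :+ (c :+ (b :+ (e :+ con 0)))) := e :+ (((t :+ c) :+ b) :+ d)) refl (ending m k empty) (ending m k top) (ending m k center) (ending m k bottom) (ending m k topBottom)

  top-weight0 : ∀ m → ending m 0 top ≡ 0
  top-weight0 zero = refl
  top-weight0 (suc m) = refl

  center-weight0 : ∀ m → ending m 0 center ≡ 0
  center-weight0 zero = refl
  center-weight0 (suc m) = refl

  bottom-weight0 : ∀ m → ending m 0 bottom ≡ 0
  bottom-weight0 zero = refl
  bottom-weight0 (suc m) = refl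

  topBottom-weight0 : ∀ m → ending m 0 topBottom ≡ 0
  topBottom-weight0 zero = refl
  topBottom-weight0 (suc m) = refl

  empty-weight0 : ∀ m → ending m 0 empty ≡ 1
  empty-weight0 zero = refl
  empty-weight0 (suc m)
    rewrite empty-step m 0 | empty-weight0 m | top-weight0 m | center-weight0 m | bottom-weight0 m | topBottom-weight0 m = refl

  top-weight1 : ∀ m → ending m 1 top ≡ 1
  top-weight1 zero = refl
  top-weight1 (suc m) rewrite top-step m 0 | empty-weight0 m | center-weight0 m | bottom-weight0 m = refl

  center-weight1 : ∀ m → ending m 1 center ≡ 1
  center-weight1 zero = refl
  center-weight1 (suc m)
    rewrite center-step m 0 | empty-weight0 m | top-weight0 m | bottom-weight0 m | topBottom-weight0 m = refl

  bottom-weight1 : ∀ m → ending m 1 bottom ≡ 1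
  bottom-weight1 zero = refl
  bottom-weight1 (suc m) rewrite bottom-step m 0 | empty-weight0 m | top-weight0 m | center-weight0 m = refl

  topBottom-weight1 : ∀ m → ending m 1 topBottom ≡ 0
  topBottom-weight1 zero = refl
  topBottom-weight1 (suc m) = refl

module CountSequences where

  open import Defs
  open import Data.Nat as ℕ using (ℕ; suc)
  open import Data.Rational using (_+_; _-_)
  open import Data.Rational.Solver using (module +-*-Solver)
  open +-*-Solver using (solve; _:+_; _:-_; _:=_)
  open import Relation.Binary.PropositionalEquality
  open NatEmbedding
  open FiniteDifferences
  open GridCounting
  open TransferRecurrences

  seqOf : Column → ℕ → Seq
  seqOf d k m = ℕtoℚ (ending m k d)

  top-rec : ∀ k m → seqOf top (suc k) (suc m) ≡ (seqOf empty k +ₛ seqOf center k +ₛ seqOf bottom k) m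
  top-rec k m = trans (cong ℕtoℚ (top-step m k)) (ℕtoℚ-+₃ (ending m k empty) (ending m k center) (ending m k bottom))

  bottom-rec : ∀ k m → seqOf bottom (suc k) (suc m) ≡ (seqOf empty k +ₛ seqOf top k +ₛ seqOf center k) m
  bottom-rec k m = trans (cong ℕtoℚ (bottom-step m k)) (ℕtoℚ-+₃ (ending m k empty) (ending m k top) (ending m k center))

  center-rec : ∀ k m → seqOf center (suc k) (suc m) ≡ (seqOf empty k +ₛ seqOf top k +ₛ seqOf bottom k +ₛ seqOf topBottom k) m
  center-rec k m = trans (cong ℕtoℚ (center-step m k)) (ℕtoℚ-+₄ (ending m k empty) (ending m k top) (ending m k bottom) (ending m k topBottom))

  topBottom-rec : ∀ k m → seqOf topBottom (suc (suc k)) (suc m) ≡ (seqOf empty k +ₛ seqOf center k) m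
  topBottom-rec k m = trans (cong ℕtoℚ (topBottom-step m k)) (ℕtoℚ-+ (ending m k empty) (ending m k center))

  empty-rec : ∀ k m → Δ (seqOf empty k) m ≡ (seqOf top k +ₛ seqOf center k +ₛ seqOf bottom k +ₛ seqOf topBottom k) m
  empty-rec k m = begin
    ℕtoℚ (ending (suc m) k empty) - e                 ≡⟨ cong (_- e) (trans (cong ℕtoℚ (empty-step m k)) (ℕtoℚ-+ (ending m k empty) _)) ⟩
    (e + ℕtoℚ (((t′ ℕ.+ c′) ℕ.+ b′) ℕ.+ d′)) - e       ≡⟨ cong (λ s → (e + s) - e) (ℕtoℚ-+₄ t′ c′ b′ d′) ⟩
    (e + s) - e                                       ≡⟨ solve 2 (λ e s → (e :+ s) :- e := s) refl e s ⟩
    s                                                 ∎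
    where
    open ≡-Reasoning
    e = seqOf empty k m
    t′ = ending m k top
    c′ = ending m k center
    b′ = ending m k bottom
    d′ = ending m k topBottom
    s = ((ℕtoℚ t′ + ℕtoℚ c′) + ℕtoℚ b′) + ℕtoℚ d′

module WeightInduction where

  open import Defs
  open import Data.Nat as ℕ using (ℕ; zero; suc; _^_)
  import Data.Nat.Properties as ℕ
  open import Data.Rational using (ℚ; 0ℚ; _+_)
  open import Data.Rational.Solver using (module +-*-Solver)
  open +-*-Solver using (solve; _:+_; _:=_; con)
  open import Relation.Nullary using (¬_)
  open import Relation.Binary.PropositionalEquality
  open NatEmbedding
  open FiniteDifferences
  open TransferRecurrences
  open CountSequences

  pow3 : ℕ → ℚ
  pow3 j = ℕtoℚ (3 ^ j)

  pow3-suc : ∀ j → ((pow3 j + pow3 j) + pow3 j) + 0ℚ ≡ pow3 (suc j)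
  pow3-suc j = begin
    ((p + p) + p) + 0ℚ                                       ≡⟨ solve 1 (λ p → ((p :+ p) :+ p) :+ con 0ℚ := p :+ (p :+ (p :+ con 0ℚ))) refl p ⟩
    p + (p + (p + ℕtoℚ 0))                                   ≡⟨ cong (λ z → p + (p + z)) (sym (ℕtoℚ-+ (3 ^ j) 0)) ⟩
    p + (p + ℕtoℚ (3 ^ j ℕ.+ 0))                             ≡⟨ cong (p +_) (sym (ℕtoℚ-+ (3 ^ j) _)) ⟩
    p + ℕtoℚ (3 ^ j ℕ.+ (3 ^ j ℕ.+ 0))                       ≡⟨ sym (ℕtoℚ-+ (3 ^ j) _) ⟩
    pow3 (suc j) ∎
    where
    open ≡-Reasoning
    p = pow3 j

  -- 3^j ≠ 0, so all degrees are exact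
  pow3-nonzero : ∀ j → ¬ (pow3 j ≡ 0ℚ)
  pow3-nonzero j eq with ℕ.m^n≡0⇒m≡0 3 j (ℕtoℚ-injective eq)
  ... | ()

  record Level (j : ℕ) : Set where
    field
      top-diff       : ConstDiff j j (seqOf top (suc j)) (pow3 j)
      center-diff    : ConstDiff j j (seqOf center (suc j)) (pow3 j)
      bottom-diff    : ConstDiff j j (seqOf bottom (suc j)) (pow3 j)
      topBottom-diff : ConstDiff j j (seqOf topBottom (suc j)) 0ℚ

  record Lower (j : ℕ) : Set where
    field
      empty-diff  : ConstDiff j j (seqOf empty j) (pow3 j)
      center-diff : ConstDiff j j (seqOf center j) 0ℚ

  -- Δ e = t + c + b + d raises the degree by one: 3^(j+1) = 3 · 3^j
  empty-diff-from : ∀ {j} → Level j → ConstDiff (suc j) j (seqOf empty (suc j)) (pow3 (suc j))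
  empty-diff-from {j} L = subst (ConstDiff (suc j) j _) (pow3-suc j)
    (integrate (λ m _ → empty-rec (suc j) m) (add (add (add top-diff center-diff) bottom-diff) topBottom-diff))
    where open Level L

  -- d(m + 1) = e(m) + c(m) one weight lower: order j, value 3^j, from j + 1 on
  topBottom-diff-from : ∀ {j} → Lower j → ConstDiff j (suc j) (seqOf topBottom (suc (suc j))) (pow3 j)
  topBottom-diff-from {j} L = next (λ m _ → topBottom-rec j m) (add-vanishing empty-diff center-diff)
    where open Lower L

  lower-step : ∀ {j} → Level j → Lower (suc j)
  lower-step {j} L = record
    { empty-diff  = later (ℕ.n≤1+n j) (empty-diff-from L)
    ; center-diff = later (ℕ.n≤1+n j) (raise (Level.center-diff L)) }

  level-step : ∀ {j} → Lower j → Level j → Level (suc j)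
  level-step {j} low L = record
    { top-diff       = next (λ m _ → top-rec (suc j) m) (add-vanishing (add-vanishing E (raise center-diff)) (raise bottom-diff))
    ; center-diff    = next (λ m _ → center-rec (suc j) m)
                         (add-vanishing (add-vanishing (add-vanishing E (raise top-diff)) (raise bottom-diff)) (raise topBottom-diff))
    ; bottom-diff    = next (λ m _ → bottom-rec (suc j) m) (add-vanishing (add-vanishing E (raise top-diff)) (raise center-diff))
    ; topBottom-diff = raise (topBottom-diff-from low) }
    where
    open Level L
    E = empty-diff-from L

  level : ∀ j → Level j
  lower : ∀ j → Lower j
  level zero = record
    { top-diff       = constant (λ m → cong ℕtoℚ (top-weight1 m))
    ; center-diff    = constant (λ m → cong ℕtoℚ (center-weight1 m))
    ; bottom-diff    = constant (λ m → cong ℕtoℚ (bottom-weight1 m))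
    ; topBottom-diff = constant (λ m → cong ℕtoℚ (topBottom-weight1 m)) }
  level (suc j) = level-step (lower j) (level j)
  lower zero = record
    { empty-diff  = constant (λ m → cong ℕtoℚ (empty-weight0 m))
    ; center-diff = constant (λ m → cong ℕtoℚ (center-weight0 m)) }
  lower (suc j) = lower-step (level j)

open import Data.Nat using (suc; z≤n; s≤s)
open import Data.Nat.Properties using (n≤1+n)
open import Data.Product using (_,_)
open import Relation.Binary.PropositionalEquality using (cong)
open FiniteDifferences
open NewtonInterpolation
open TransferRecurrences
open CountSequences
open WeightInduction

combine : ∀ {N db dc dd dp} {fb fc fd fp : Seq} →
  PolynomialFrom N fb db → PolynomialFrom N fc dc → PolynomialFrom N fd dd → PolynomialFrom N fp dp →
  Σ Poly λ b → Σ Poly λ c → Σ Poly λ d → Σ Poly λ p →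
    ((n : ℕ) → N ≤ n → (fb n ≡ eval b (ℕtoℚ n)) × (fc n ≡ eval c (ℕtoℚ n)) × (fd n ≡ eval d (ℕtoℚ n)) × (fp n ≡ eval p (ℕtoℚ n)))
    × HasDegree b db × HasDegree c dc × HasDegree d dd × HasDegree p dp
combine (b , b-agrees , b-degree) (c , c-agrees , c-degree) (d , d-agrees , d-degree) (p , p-agrees , p-degree) =
  b , c , d , p ,
  (λ n N≤n → b-agrees n N≤n , c-agrees n N≤n , d-agrees n N≤n , p-agrees n N≤n) ,
  b-degree , c-degree , d-degree , p-degree

proposition15 : (k : ℕ) → 2 ≤ k →
    Σ Poly λ b → Σ Poly λ c → Σ Poly λ d → Σ Poly λ p →
      ((n : ℕ) → k ≤ n →
          (ℕtoℚ (Tb n k) ≡ eval b (ℕtoℚ n))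
        × (ℕtoℚ (Tc n k) ≡ eval c (ℕtoℚ n))
        × (ℕtoℚ (Td n k) ≡ eval d (ℕtoℚ n))
        × (ℕtoℚ (T n k) ≡ eval p (ℕtoℚ n)))
      × HasDegree b (k ∸ 1) × HasDegree c (k ∸ 1) × HasDegree d (k ∸ 2) × HasDegree p k
proposition15 (suc (suc j)) (s≤s (s≤s z≤n)) =
  combine (eventually-polynomial Tb-diff (pow3-nonzero (suc j)))
          (eventually-polynomial Tc-diff (pow3-nonzero (suc j)))
          (eventually-polynomial Td-diff (pow3-nonzero j))
          (eventually-polynomial T-diff (pow3-nonzero (suc (suc j))))
  where
  k = suc (suc j)
  open Level (level (suc j))
  Tb-diff : ConstDiff (suc j) k (λ n → ℕtoℚ (Tb n k)) (pow3 (suc j))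
  Tb-diff = next (λ m _ → cong ℕtoℚ (Tb-ending m k)) bottom-diff
  Tc-diff : ConstDiff (suc j) k (λ n → ℕtoℚ (Tc n k)) (pow3 (suc j))
  Tc-diff = next (λ m _ → cong ℕtoℚ (Tc-ending m k)) center-diff
  Td-diff : ConstDiff j k (λ n → ℕtoℚ (Td n k)) (pow3 j)
  Td-diff = next (λ m _ → cong ℕtoℚ (Td-ending m k)) (topBottom-diff-from (lower j))
  T-diff : ConstDiff k k (λ n → ℕtoℚ (T n k)) (pow3 k)
  T-diff = later (n≤1+n (suc j)) (extend T-empty (empty-diff-from (level (suc j))))
    where
    T-empty : AgreeFrom (suc j) (λ n → ℕtoℚ (T n k)) (seqOf empty k)
    T-empty (suc m) _ = cong ℕtoℚ (T-ending m k)
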